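{- Let $k\ge 1$. For any two distinct sets $\{a,b\},\{a',b'\}\in C_k$ with $a<b$ and $a'<b'$ we have $a\ne a'$ and $b\ne b'$.
   Context: For an integer $t\ge1$ and a set $x$ of integers, $t\cdot x:=\{ti\mid i\in x\}$, and for a family $X$ of sets, $t\cdot X:=\{t\cdot x\mid x\in X\}$. Define $O_1:=C_1:=\emptyset$, and for $k\ge 2$: $O_k:=\{\{1,3\},\{3,5\},\ldots,\{2^k-3,2^k-1\}\}$ (all sets $\{2i-1,2i+1\}$ for $1\le i\le 2^{k-1}-1$) and $C_k:=O_k\cup 2\cdot C_{k-1}$. -}

module Defs where

open import Data.Nat using (ℕ; zero; suc; _+_; _*_; _∸_; _^_; _≤_; _<_)
open import Data.Product using (Σ; ∃; _×_; _,_)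
open import Data.Sum using (_⊎_)
open import Data.Empty using (⊥)
open import Relation.Binary.PropositionalEquality using (_≡_)

-- A two-element set is represented by an ordered pair of its elements (x , y);
-- generated pairs always have x < y.

GenO : ℕ → ℕ → ℕ → Set
GenO k x y = 2 ≤ k × Σ ℕ λ i → 1 ≤ i × i ≤ 2 ^ (k ∸ 1) ∸ 1 × x ≡ 2 * i ∸ 1 × y ≡ 2 * i + 1

GenC : ℕ → ℕ → ℕ → Set
GenC zero    x y = ⊥
GenC (suc zero) x y = ⊥
GenC (suc (suc k)) x y =
  GenO (suc (suc k)) x y ⊎
  Σ ℕ λ x₀ → Σ ℕ λ y₀ → GenC (suc k) x₀ y₀ × x ≡ 2 * x₀ × y ≡ 2 * y₀

_∈C[_] : ℕ × ℕ → ℕ → Set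
(a , b) ∈C[ k ] = Σ ℕ λ x → Σ ℕ λ y → GenC k x y ×
  ((x ≡ a × y ≡ b) ⊎ (x ≡ b × y ≡ a))

SameSet : ℕ × ℕ → ℕ × ℕ → Set
SameSet (a , b) (a' , b') = (a ≡ a' × b ≡ b') ⊎ (a ≡ b' × b ≡ a')

-- Pairs of O_k consist of odd numbers, pairs of 2·C_{k-1} of even numbers, so
-- within C_k a pair of one kind never shares an endpoint with a pair of the
-- other kind. Within O_k, either endpoint determines the index i; within
-- 2·C_{k-1}, halving reduces to C_{k-1}. Hence in C_k the smaller element of a
-- pair determines the larger one and vice versa, which is the claim once both
-- pairs are oriented increasingly.
module Submission where

open import Defs
open import Data.Nat using (ℕ; suc; _+_; _*_; _∸_; _≤_; _<_)
open import Data.Nat.Properties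
  using (*-suc; +-comm; *-cancelˡ-≡; suc-injective; *-monoʳ-<; +-monoʳ-<; n<1+n; <-asym)
open import Data.Nat.Divisibility using (_∣_; m∣m*n; ∣m+n∣m⇒∣n; ∣1⇒≡1)
open import Data.Product using (_×_; _,_; ∃)
open import Data.Sum using (inj₁; inj₂)
open import Data.Empty using (⊥-elim)
open import Relation.Nullary using (¬_; contradiction)
open import Relation.Binary.PropositionalEquality

odd≢even : ∀ m n → 1 + 2 * m ≢ 2 * n
odd≢even m n eq = contradiction (∣1⇒≡1 (∣m+n∣m⇒∣n 2∣2m+1 (m∣m*n m))) λ ()
  where
  2∣2m+1 : 2 ∣ 2 * m + 1
  2∣2m+1 = subst (2 ∣_) (trans (sym eq) (+-comm 1 (2 * m))) (m∣m*n n)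

odd-injective : ∀ {m n} → 1 + 2 * m ≡ 1 + 2 * n → m ≡ n
odd-injective {m} {n} eq = *-cancelˡ-≡ m n 2 (suc-injective eq)

GenO⇒consecutive-odd : ∀ {k x y} → GenO k x y →
  ∃ λ m → x ≡ 1 + 2 * m × y ≡ 1 + 2 * suc m
GenO⇒consecutive-odd (_ , suc m , _ , _ , refl , refl) =
  m , cong (_∸ 1) (*-suc 2 m) , +-comm (2 * suc m) 1

GenC⇒< : ∀ k {x y} → GenC k x y → x < y
GenC⇒< (suc (suc k)) (inj₁ o) with GenO⇒consecutive-odd o
... | m , refl , refl = +-monoʳ-< 1 (*-monoʳ-< 2 (n<1+n m))
GenC⇒< (suc (suc k)) (inj₂ (_ , _ , g , refl , refl)) = *-monoʳ-< 2 (GenC⇒< (suc k) g)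

GenC-functional : ∀ k {x y y'} → GenC k x y → GenC k x y' → y ≡ y'
GenC-functional (suc (suc k)) (inj₁ o) (inj₁ o')
  with GenO⇒consecutive-odd o | GenO⇒consecutive-odd o'
... | m , refl , refl | m' , x≡ , refl = cong (λ n → 1 + 2 * suc n) (odd-injective x≡)
GenC-functional (suc (suc k)) (inj₁ o) (inj₂ (x₀ , _ , _ , x≡ , _))
  with GenO⇒consecutive-odd o
... | m , refl , _ = ⊥-elim (odd≢even m x₀ x≡)
GenC-functional (suc (suc k)) (inj₂ (x₀ , _ , _ , x≡ , _)) (inj₁ o)
  with GenO⇒consecutive-odd o
... | m , refl , _ = ⊥-elim (odd≢even m x₀ x≡)
GenC-functional (suc (suc k)) (inj₂ (x₀ , _ , g , refl , refl)) (inj₂ (x₁ , _ , g' , x≡ , refl))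
  with *-cancelˡ-≡ x₀ x₁ 2 x≡
... | refl = cong (2 *_) (GenC-functional (suc k) g g')

GenC-injective : ∀ k {x x' y} → GenC k x y → GenC k x' y → x ≡ x'
GenC-injective (suc (suc k)) (inj₁ o) (inj₁ o')
  with GenO⇒consecutive-odd o | GenO⇒consecutive-odd o'
... | m , refl , refl | m' , refl , y≡ = cong (λ n → 1 + 2 * n) (suc-injective (odd-injective y≡))
GenC-injective (suc (suc k)) (inj₁ o) (inj₂ (_ , y₀ , _ , _ , y≡))
  with GenO⇒consecutive-odd o
... | m , _ , refl = ⊥-elim (odd≢even (suc m) y₀ y≡)
GenC-injective (suc (suc k)) (inj₂ (_ , y₀ , _ , _ , y≡)) (inj₁ o)
  with GenO⇒consecutive-odd o
... | m , _ , refl = ⊥-elim (odd≢even (suc m) y₀ y≡)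
GenC-injective (suc (suc k)) (inj₂ (_ , y₀ , g , refl , refl)) (inj₂ (_ , y₁ , g' , refl , y≡))
  with *-cancelˡ-≡ y₀ y₁ 2 y≡
... | refl = cong (2 *_) (GenC-injective (suc k) g g')

∈C⇒GenC : ∀ k {a b} → (a , b) ∈C[ k ] → a < b → GenC k a b
∈C⇒GenC k (_ , _ , g , inj₁ (refl , refl)) _   = g
∈C⇒GenC k (_ , _ , g , inj₂ (refl , refl)) a<b = ⊥-elim (<-asym a<b (GenC⇒< k g))

lemma2p2 : (k : ℕ) → 1 ≤ k → (a b a' b' : ℕ) →
    (a , b) ∈C[ k ] → (a' , b') ∈C[ k ] →
    ¬ SameSet (a , b) (a' , b') → a < b → a' < b' →
    a ≢ a' × b ≢ b'
lemma2p2 k _ a b a' b' ab∈C a'b'∈C distinct a<b a'<b' =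
  (λ { refl → distinct (inj₁ (refl , GenC-functional k g g')) }) ,
  (λ { refl → distinct (inj₁ (GenC-injective k g g' , refl)) })
  where
  g : GenC k a b
  g = ∈C⇒GenC k ab∈C a<b
  g' : GenC k a' b'
  g' = ∈C⇒GenC k a'b'∈C a'<b'
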